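{- There is a recursively enumerable set $A\subseteq\mathbb{N}$ that is both simple and $D$-w.e.u.
   Context: $\varphi_0,\varphi_1,\ldots$ is a standard enumeration of the unary partial computable functions and $\mathfrak{P}_{\mathrm{fin}}(\mathbb{N})$ is the set of finite subsets of $\mathbb{N}$ with its standard computable coding. A recursively enumerable set $A$ is simple if $\mathbb{N}\setminus A$ is infinite and contains no infinite recursively enumerable subset. $A$ is $D$-w.e.u. if there is a computable $f\colon\mathbb{N}\to\mathfrak{P}_{\mathrm{fin}}(\mathbb{N})$ such that for all $e$: if $\varphi_e(z)\downarrow$ for every $z\in f(e)$ then some $z\in f(e)$ has $\varphi_e(z)\neq\mathbb{1}_A(z)$. -}

module Defs where

open import Data.Nat using (ℕ; zero; suc; _+_; _≤_; _<_; _/_; _%_)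
open import Data.Product using (Σ; _×_; _,_; proj₁; proj₂)
open import Data.Sum using (_⊎_)
open import Relation.Binary.PropositionalEquality using (_≡_)
open import Relation.Nullary using (¬_)

tri : ℕ → ℕ
tri zero    = zero
tri (suc k) = tri k + suc k

pair : ℕ → ℕ → ℕ
pair x y = tri (x + y) + y

-- unpair enumerates (0,0),(1,0),(0,1),(2,0),(1,1),(0,2),...  (inverse of pair)
unpair : ℕ → ℕ × ℕ
unpair zero    = 0 , 0
unpair (suc n) with unpair n
... | zero  , y = suc y , 0
... | suc x , y = x , suc y

fst snd : ℕ → ℕ
fst n = proj₁ (unpair n)
snd n = proj₂ (unpair n)

-- Unary partial recursive functions (Kleene-style, with Cantor pairing
-- used to encode tuples).

data Code : Set where
  cZ cS cI cFst cSnd : Code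
  cPair cComp cRec   : Code → Code → Code
  cMu                : Code → Code

data _⟦_⟧⇓_ : Code → ℕ → ℕ → Set where
  evZ    : ∀ {x} → cZ ⟦ x ⟧⇓ 0
  evS    : ∀ {x} → cS ⟦ x ⟧⇓ suc x
  evI    : ∀ {x} → cI ⟦ x ⟧⇓ x
  evFst  : ∀ {x} → cFst ⟦ x ⟧⇓ fst x
  evSnd  : ∀ {x} → cSnd ⟦ x ⟧⇓ snd x
  evPair : ∀ {f g x a b} → f ⟦ x ⟧⇓ a → g ⟦ x ⟧⇓ b → cPair f g ⟦ x ⟧⇓ pair a b
  evComp : ∀ {f g x y v} → g ⟦ x ⟧⇓ y → f ⟦ y ⟧⇓ v → cComp f g ⟦ x ⟧⇓ v
  -- primitive recursion:  h⟨x,0⟩ = f x ,  h⟨x,y+1⟩ = g⟨x,⟨y,h⟨x,y⟩⟩⟩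
  evRec0 : ∀ {f g p x v} → unpair p ≡ (x , 0) → f ⟦ x ⟧⇓ v → cRec f g ⟦ p ⟧⇓ v
  evRecS : ∀ {f g p x y h v} → unpair p ≡ (x , suc y) →
           cRec f g ⟦ pair x y ⟧⇓ h → g ⟦ pair x (pair y h) ⟧⇓ v →
           cRec f g ⟦ p ⟧⇓ v
  evMu   : ∀ {f x y} → f ⟦ pair x y ⟧⇓ 0 →
           (∀ y′ → y′ < y → Σ ℕ λ w → f ⟦ pair x y′ ⟧⇓ suc w) →
           cMu f ⟦ x ⟧⇓ y

-- Gödel numbering: decode a natural number into a code (fuel = e suffices,
-- since the components of e = ⟨t , r⟩ with t ≥ 5 are < e).
decodeF : ℕ → ℕ → Code
decodeF zero    e = cZ
decodeF (suc k) e with fst e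
... | 0 = cZ
... | 1 = cS
... | 2 = cI
... | 3 = cFst
... | 4 = cSnd
... | 5 = cPair (decodeF k (fst (snd e))) (decodeF k (snd (snd e)))
... | 6 = cComp (decodeF k (fst (snd e))) (decodeF k (snd (snd e)))
... | 7 = cRec  (decodeF k (fst (snd e))) (decodeF k (snd (snd e)))
... | 8 = cMu   (decodeF k (snd e))
... | _ = cZ

decode : ℕ → Code
decode e = decodeF e e

_⟦_⟧φ⇓_ : ℕ → ℕ → ℕ → Set
e ⟦ x ⟧φ⇓ v = decode e ⟦ x ⟧⇓ v

Halts : ℕ → ℕ → Set
Halts e x = Σ ℕ λ v → e ⟦ x ⟧φ⇓ v

Pred : Set₁
Pred = ℕ → Set

IsRE : Pred → Set
IsRE A = Σ ℕ λ e → ∀ z → (A z → Halts e z) × (Halts e z → A z)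

Infinite : Pred → Set
Infinite P = ∀ n → Σ ℕ λ m → n ≤ m × P m

IsSimple : Pred → Set₁
IsSimple A = Infinite (λ z → ¬ A z)
           × (∀ (B : Pred) → IsRE B → (∀ z → B z → ¬ A z) → ¬ Infinite B)

IsComputable : (ℕ → ℕ) → Set
IsComputable f = Σ ℕ λ c → ∀ n → c ⟦ n ⟧φ⇓ f n

-- Standard (canonical) coding of finite sets: x ∈ D n iff bit x of n is 1.
_∈D_ : ℕ → ℕ → Set
zero  ∈D n = n % 2 ≡ 1
suc x ∈D n = x ∈D (n / 2)

IsIndicator : Pred → ℕ → ℕ → Set
IsIndicator A z b = (A z × b ≡ 1) ⊎ (¬ A z × b ≡ 0)

IsDWEU : Pred → Set
IsDWEU A = Σ (ℕ → ℕ) λ f → IsComputable f ×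
  (∀ e → (∀ z → z ∈D f e → Halts e z) →
         Σ ℕ λ z → z ∈D f e × Σ ℕ λ v → e ⟦ z ⟧φ⇓ v × ¬ IsIndicator A z v)

-- Cut ℕ into consecutive blocks I_0, K_0, I_1, K_1, ... where I_e and K_e have e + 1 elements and
-- I_e starts at e(e+1).  A contains, for each e, the first element z ≥ (e+1)(e+2) of W_e found by
-- a fixed enumeration (Post's construction), and every z ∈ I_e with φ_e(z) = 0 (diagonalisation).
-- Post's part meets every infinite W_e and has at most e elements below (e+1)(e+2), so by pigeonhole
-- K_e contains a point outside A (A is co-infinite), and so does I_e unless φ_e vanishes there.  With
-- f(e) = I_e this gives the D-w.e.u. disagreement: φ_e(z) = 0 for some z ∈ A ∩ I_e, or φ_e(z) > 0
-- at some z ∈ I_e outside A.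
--
-- Classical logic is used only for the pigeonhole step and to decide whether φ_e vanishes on I_e.

module Submission where

open import Defs
open import Level using (0ℓ)
open import Axiom.ExcludedMiddle using (ExcludedMiddle)
open import Data.Nat
open import Data.Nat.Properties
open import Data.Nat.DivMod
open import Data.Nat.GeneralisedArithmetic using (fold; fold-+)
open import Data.Nat.Solver using (module +-*-Solver)
open import Data.Fin using (Fin; toℕ; fromℕ<)
open import Data.Fin.Properties using (pigeonhole; toℕ-fromℕ<; toℕ-injective; toℕ<n) renaming (<-irrefl to Fin-<-irrefl)
open import Data.Product
open import Data.Product.Function.NonDependent.Propositional using (_×-⇔_)
open import Data.Sum using (_⊎_; inj₁; inj₂; [_,_]′)
open import Data.Sum.Function.Propositional using (_⊎-⇔_)
open import Data.Empty using (⊥; ⊥-elim)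
open import Data.Unit using (⊤; tt)
open import Function.Bundles using (_⇔_; mk⇔; Equivalence)
open import Function.Construct.Composition using (_⇔-∘_)
open import Function.Construct.Identity using (⇔-id)
open import Function.Definitions using (Injective)
open import Relation.Binary.PropositionalEquality
open import Relation.Binary.Definitions using (tri<; tri≈; tri>)
open import Relation.Nullary using (¬_; Dec; yes; no)
open import Relation.Nullary.Decidable using (decidable-stable)
open +-*-Solver using (solve; _:+_; _:*_; con; _:=_)

-- Cantor pairing: basic algebra and size bounds

pair-suc-zero : ∀ x → pair (suc x) 0 ≡ suc (pair 0 x)
pair-suc-zero x = begin
  tri (suc x + 0) + 0 ≡⟨ +-identityʳ _ ⟩
  tri (suc x + 0)     ≡⟨ cong tri (+-identityʳ (suc x)) ⟩
  tri x + suc x       ≡⟨ +-suc (tri x) x ⟩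
  suc (tri x + x)     ∎
  where open ≡-Reasoning

pair-suc : ∀ x y → pair x (suc y) ≡ suc (pair (suc x) y)
pair-suc x y = begin
  tri (x + suc y) + suc y   ≡⟨ cong (λ k → tri k + suc y) (+-suc x y) ⟩
  tri (suc (x + y)) + suc y ≡⟨ +-suc _ y ⟩
  suc (pair (suc x) y)      ∎
  where open ≡-Reasoning

unpair-pair′ : ∀ m x y → pair x y ≡ m → unpair m ≡ (x , y)
unpair-pair′ zero    zero    zero    eq = refl
unpair-pair′ zero    (suc x) zero    eq with () ← trans (sym (pair-suc-zero x)) eq
unpair-pair′ zero    x       (suc y) eq with () ← trans (sym (pair-suc x y)) eq
unpair-pair′ (suc m) (suc x) zero    eq
  rewrite unpair-pair′ m 0 x (suc-injective (trans (sym (pair-suc-zero x)) eq)) = refl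
unpair-pair′ (suc m) x       (suc y) eq
  rewrite unpair-pair′ m (suc x) y (suc-injective (trans (sym (pair-suc x y)) eq)) = refl

unpair-pair : ∀ x y → unpair (pair x y) ≡ (x , y)
unpair-pair x y = unpair-pair′ _ x y refl

fst-pair : ∀ x y → fst (pair x y) ≡ x
fst-pair x y = cong proj₁ (unpair-pair x y)

snd-pair : ∀ x y → snd (pair x y) ≡ y
snd-pair x y = cong proj₂ (unpair-pair x y)

pair-fst-snd : ∀ n → pair (fst n) (snd n) ≡ n
pair-fst-snd zero = refl
pair-fst-snd (suc n) with unpair n | pair-fst-snd n
... | zero  , y | eq = trans (pair-suc-zero y) (cong suc eq)
... | suc x , y | eq = trans (pair-suc x y) (cong suc eq)

k≤tri : ∀ k → k ≤ tri k
k≤tri zero    = z≤n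
k≤tri (suc k) = ≤-trans (s≤s (m≤n+m k (tri k))) (≤-reflexive (sym (+-suc (tri k) k)))

fst≤ : ∀ n → fst n ≤ n
fst≤ n = subst (fst n ≤_) (pair-fst-snd n)
  (≤-trans (m≤m+n (fst n) (snd n)) (≤-trans (k≤tri _) (m≤m+n _ (snd n))))

snd≤ : ∀ n → snd n ≤ n
snd≤ n = subst (snd n ≤_) (pair-fst-snd n) (m≤n+m (snd n) _)

snd< : ∀ n {t} → fst n ≡ suc t → snd n < n
snd< n {t} eq = subst (snd n <_) (pair-fst-snd n) (subst (λ x → snd n < pair x (snd n)) (sym eq)
  (≤-trans (s≤s (m≤n+m (snd n) t)) (≤-trans (k≤tri (suc t + snd n)) (m≤m+n _ (snd n)))))

-- Gödel numbering: a code number e = ⟨t , ⟨a , b⟩⟩ has tag t and arguments a, b.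

arg₁ arg₂ : ℕ → ℕ
arg₁ e = fst (snd e)
arg₂ e = snd (snd e)

arg₁< : ∀ e {t} → fst e ≡ suc t → arg₁ e < e
arg₁< e eq = ≤-<-trans (fst≤ (snd e)) (snd< e eq)

arg₂< : ∀ e {t} → fst e ≡ suc t → arg₂ e < e
arg₂< e eq = ≤-<-trans (snd≤ (snd e)) (snd< e eq)

<-fuel : ∀ {a n j} → a < n → n ≤ suc j → a ≤ j
<-fuel a<n n≤1+j = ≤-pred (≤-trans a<n n≤1+j)

decodeF-stable : ∀ j k n → n ≤ j → n ≤ k → decodeF j n ≡ decodeF k n
decodeF-stable zero    zero    n       p q = refl
decodeF-stable zero    (suc k) zero    p q = refl
decodeF-stable (suc j) zero    zero    p q = refl
decodeF-stable (suc j) (suc k) n       p q with fst n in eq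
... | 0 = refl
... | 1 = refl
... | 2 = refl
... | 3 = refl
... | 4 = refl
... | 5 = cong₂ cPair (decodeF-stable j k _ (<-fuel (arg₁< n eq) p) (<-fuel (arg₁< n eq) q))
                      (decodeF-stable j k _ (<-fuel (arg₂< n eq) p) (<-fuel (arg₂< n eq) q))
... | 6 = cong₂ cComp (decodeF-stable j k _ (<-fuel (arg₁< n eq) p) (<-fuel (arg₁< n eq) q))
                      (decodeF-stable j k _ (<-fuel (arg₂< n eq) p) (<-fuel (arg₂< n eq) q))
... | 7 = cong₂ cRec (decodeF-stable j k _ (<-fuel (arg₁< n eq) p) (<-fuel (arg₁< n eq) q))
                     (decodeF-stable j k _ (<-fuel (arg₂< n eq) p) (<-fuel (arg₂< n eq) q))
... | 8 = cong cMu (decodeF-stable j k _ (<-fuel (snd< n eq) p) (<-fuel (snd< n eq) q))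
... | suc (suc (suc (suc (suc (suc (suc (suc (suc _)))))))) = refl

decodeF-decode : ∀ m a → a < suc m → decodeF m a ≡ decode a
decodeF-decode m a a≤m = decodeF-stable m a a (≤-pred a≤m) ≤-refl

shape : ℕ → ℕ → Code
shape 0 e = cZ
shape 1 e = cS
shape 2 e = cI
shape 3 e = cFst
shape 4 e = cSnd
shape 5 e = cPair (decode (arg₁ e)) (decode (arg₂ e))
shape 6 e = cComp (decode (arg₁ e)) (decode (arg₂ e))
shape 7 e = cRec (decode (arg₁ e)) (decode (arg₂ e))
shape 8 e = cMu (decode (snd e))
shape (suc (suc (suc (suc (suc (suc (suc (suc (suc _))))))))) e = cZ

-- Decoding unfolds one layer at a time: the arguments of e are below e, so the fuel left suffices.
decode-unfold : ∀ e → decode e ≡ shape (fst e) e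
decode-unfold zero = refl
decode-unfold (suc m) with fst (suc m) in eq
... | 0 = refl
... | 1 = refl
... | 2 = refl
... | 3 = refl
... | 4 = refl
... | 5 = cong₂ cPair (decodeF-decode m _ (arg₁< (suc m) eq)) (decodeF-decode m _ (arg₂< (suc m) eq))
... | 6 = cong₂ cComp (decodeF-decode m _ (arg₁< (suc m) eq)) (decodeF-decode m _ (arg₂< (suc m) eq))
... | 7 = cong₂ cRec (decodeF-decode m _ (arg₁< (suc m) eq)) (decodeF-decode m _ (arg₂< (suc m) eq))
... | 8 = cong cMu (decodeF-decode m _ (snd< (suc m) eq))
... | suc (suc (suc (suc (suc (suc (suc (suc (suc _)))))))) = refl

decode-tag : ∀ e {t} → fst e ≡ t → decode e ≡ shape t e
decode-tag e refl = decode-unfold e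

Shape : ℕ → ℕ → Code → Set
Shape t e cZ          = t ≡ 0 ⊎ 9 ≤ t
Shape t e cS          = t ≡ 1
Shape t e cI          = t ≡ 2
Shape t e cFst        = t ≡ 3
Shape t e cSnd        = t ≡ 4
Shape t e (cPair f g) = t ≡ 5 × decode (arg₁ e) ≡ f × decode (arg₂ e) ≡ g
Shape t e (cComp f g) = t ≡ 6 × decode (arg₁ e) ≡ f × decode (arg₂ e) ≡ g
Shape t e (cRec f g)  = t ≡ 7 × decode (arg₁ e) ≡ f × decode (arg₂ e) ≡ g
Shape t e (cMu f)     = t ≡ 8 × decode (snd e) ≡ f

shape-Shape : ∀ t e → Shape t e (shape t e)
shape-Shape 0 e = inj₁ refl
shape-Shape 1 e = refl
shape-Shape 2 e = refl
shape-Shape 3 e = refl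
shape-Shape 4 e = refl
shape-Shape 5 e = refl , refl , refl
shape-Shape 6 e = refl , refl , refl
shape-Shape 7 e = refl , refl , refl
shape-Shape 8 e = refl , refl
shape-Shape (suc (suc (suc (suc (suc (suc (suc (suc (suc t))))))))) e = inj₂ (m≤m+n 9 t)

decode-inv : ∀ e {c} → decode e ≡ c → Shape (fst e) e c
decode-inv e h = subst (Shape (fst e) e) (trans (sym (decode-unfold e)) h) (shape-Shape (fst e) e)

arg₁-pair : ∀ t a b → arg₁ (pair t (pair a b)) ≡ a
arg₁-pair t a b = trans (cong fst (snd-pair t (pair a b))) (fst-pair a b)

arg₂-pair : ∀ t a b → arg₂ (pair t (pair a b)) ≡ b
arg₂-pair t a b = trans (cong snd (snd-pair t (pair a b))) (snd-pair a b)

encode : Code → ℕ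
encode cZ          = pair 0 0
encode cS          = pair 1 0
encode cI          = pair 2 0
encode cFst        = pair 3 0
encode cSnd        = pair 4 0
encode (cPair f g) = pair 5 (pair (encode f) (encode g))
encode (cComp f g) = pair 6 (pair (encode f) (encode g))
encode (cRec f g)  = pair 7 (pair (encode f) (encode g))
encode (cMu f)     = pair 8 (encode f)

decode-args : ∀ t a b {f g} → decode a ≡ f → decode b ≡ g →
              decode (arg₁ (pair t (pair a b))) ≡ f × decode (arg₂ (pair t (pair a b))) ≡ g
decode-args t a b a↦f b↦g = trans (cong decode (arg₁-pair t a b)) a↦f , trans (cong decode (arg₂-pair t a b)) b↦g

decode-encode : ∀ c → decode (encode c) ≡ c
decode-encode cZ    = refl
decode-encode cS    = decode-tag (pair 1 0) (fst-pair 1 0)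
decode-encode cI    = decode-tag (pair 2 0) (fst-pair 2 0)
decode-encode cFst  = decode-tag (pair 3 0) (fst-pair 3 0)
decode-encode cSnd  = decode-tag (pair 4 0) (fst-pair 4 0)
decode-encode c@(cPair f g) = trans (decode-tag (encode c) (fst-pair 5 (pair (encode f) (encode g))))
  (uncurry (cong₂ cPair) (decode-args 5 (encode f) (encode g) (decode-encode f) (decode-encode g)))
decode-encode c@(cComp f g) = trans (decode-tag (encode c) (fst-pair 6 (pair (encode f) (encode g))))
  (uncurry (cong₂ cComp) (decode-args 6 (encode f) (encode g) (decode-encode f) (decode-encode g)))
decode-encode c@(cRec f g)  = trans (decode-tag (encode c) (fst-pair 7 (pair (encode f) (encode g))))
  (uncurry (cong₂ cRec) (decode-args 7 (encode f) (encode g) (decode-encode f) (decode-encode g)))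
decode-encode c@(cMu f)     = trans (decode-tag (encode c) (fst-pair 8 (encode f)))
  (cong cMu (trans (cong decode (snd-pair 8 (encode f))) (decode-encode f)))

⇓-det : ∀ {c x v v′} → c ⟦ x ⟧⇓ v → c ⟦ x ⟧⇓ v′ → v ≡ v′
⇓-det evZ   evZ   = refl
⇓-det evS   evS   = refl
⇓-det evI   evI   = refl
⇓-det evFst evFst = refl
⇓-det evSnd evSnd = refl
⇓-det (evPair d₁ d₂) (evPair d₁′ d₂′) = cong₂ pair (⇓-det d₁ d₁′) (⇓-det d₂ d₂′)
⇓-det (evComp d₁ d₂) (evComp d₁′ d₂′) with refl ← ⇓-det d₁ d₁′ = ⇓-det d₂ d₂′
⇓-det (evRec0 u d) (evRec0 u′ d′) with refl ← cong proj₁ (trans (sym u) u′) = ⇓-det d d′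
⇓-det (evRec0 u d) (evRecS u′ _ _) with () ← cong proj₂ (trans (sym u) u′)
⇓-det (evRecS u _ _) (evRec0 u′ d′) with () ← cong proj₂ (trans (sym u) u′)
⇓-det (evRecS u d₁ d₂) (evRecS u′ d₁′ d₂′)
  with refl ← cong proj₁ (trans (sym u) u′) | refl ← cong proj₂ (trans (sym u) u′)
  with refl ← ⇓-det d₁ d₁′ = ⇓-det d₂ d₂′
⇓-det (evMu {y = y} d₀ below) (evMu {y = y′} d₀′ below′) with <-cmp y y′
... | tri≈ _ y≡y′ _ = y≡y′
... | tri< y<y′ _ _ with () ← ⇓-det d₀ (proj₂ (below′ y y<y′))
... | tri> _ _ y′<y with () ← ⇓-det (proj₂ (below y′ y′<y)) d₀′

record Prog (F : ℕ → ℕ) : Set where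
  constructor prog
  field
    code : Code
    runs : ∀ x → code ⟦ x ⟧⇓ F x
open Prog public

prog-≗ : ∀ {F G} → Prog F → (∀ x → F x ≡ G x) → Prog G
prog-≗ (prog c runs) F≗G = prog c (λ x → subst (c ⟦ x ⟧⇓_) (F≗G x) (runs x))

Z′ : Prog (λ _ → 0)
Z′ = prog cZ (λ _ → evZ)

S′ : Prog suc
S′ = prog cS (λ _ → evS)

I′ : Prog (λ x → x)
I′ = prog cI (λ _ → evI)

fst′ : Prog fst
fst′ = prog cFst (λ _ → evFst)

snd′ : Prog snd
snd′ = prog cSnd (λ _ → evSnd)

infixr 9 _∘′_
_∘′_ : ∀ {F G} → Prog F → Prog G → Prog (λ x → F (G x))
prog f f-runs ∘′ prog g g-runs = prog (cComp f g) (λ x → evComp (g-runs x) (f-runs _))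

⟨_,_⟩′ : ∀ {F G} → Prog F → Prog G → Prog (λ x → pair (F x) (G x))
⟨ prog f f-runs , prog g g-runs ⟩′ = prog (cPair f g) (λ x → evPair (f-runs x) (g-runs x))

prec : (ℕ → ℕ) → (ℕ → ℕ → ℕ → ℕ) → ℕ → ℕ → ℕ
prec F S x zero    = F x
prec F S x (suc y) = S x y (prec F S x y)

prec′ : ∀ {F S} → Prog F → Prog (λ q → S (fst q) (arg₁ q) (arg₂ q)) → Prog (λ p → prec F S (fst p) (snd p))
prec′ {F} {S} (prog f f-runs) (prog g g-runs) =
  prog (cRec f g) (λ p → subst (λ q → cRec f g ⟦ q ⟧⇓ prec F S (fst p) (snd p)) (pair-fst-snd p) (at (fst p) (snd p)))
  where
  at : ∀ x y → cRec f g ⟦ pair x y ⟧⇓ prec F S x y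
  at x zero    = evRec0 (unpair-pair x 0) (f-runs x)
  at x (suc y) = evRecS (unpair-pair x (suc y)) (at x y) (subst (g ⟦ pair x (pair y h) ⟧⇓_) step (g-runs _))
    where
    h : ℕ
    h = prec F S x y
    step : S (fst (pair x (pair y h))) (arg₁ (pair x (pair y h))) (arg₂ (pair x (pair y h))) ≡ S x y h
    step rewrite fst-pair x (pair y h) | arg₁-pair x y h | arg₂-pair x y h = refl

lift₂ : ∀ {B : ℕ → ℕ → ℕ} {F G} → Prog (λ p → B (fst p) (snd p)) → Prog F → Prog G → Prog (λ x → B (F x) (G x))
lift₂ {B} {F} {G} pb pf pg = prog-≗ (pb ∘′ ⟨ pf , pg ⟩′) (λ x → cong₂ B (fst-pair (F x) (G x)) (snd-pair (F x) (G x)))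

K′ : ∀ k → Prog (λ _ → k)
K′ zero    = Z′
K′ (suc k) = S′ ∘′ K′ k

infixl 6 _+′_ _∸′_
infixl 7 _*′_

_+′_ : ∀ {F G} → Prog F → Prog G → Prog (λ x → F x + G x)
_+′_ = lift₂ {_+_} (prog-≗ (prec′ {S = λ _ _ h → suc h} I′ (S′ ∘′ snd′ ∘′ snd′)) (λ p → add (fst p) (snd p)))
  where
  add : ∀ x y → prec (λ x → x) (λ _ _ h → suc h) x y ≡ x + y
  add x zero    = sym (+-identityʳ x)
  add x (suc y) = trans (cong suc (add x y)) (sym (+-suc x y))

_*′_ : ∀ {F G} → Prog F → Prog G → Prog (λ x → F x * G x)
_*′_ = lift₂ {_*_} (prog-≗ (prec′ {S = λ x _ h → h + x} Z′ (snd′ ∘′ snd′ +′ fst′)) (λ p → mul (fst p) (snd p)))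
  where
  mul : ∀ x y → prec (λ _ → 0) (λ x _ h → h + x) x y ≡ x * y
  mul x zero    = sym (*-zeroʳ x)
  mul x (suc y) = trans (cong (_+ x) (mul x y)) (trans (+-comm (x * y) x) (sym (*-suc x y)))

pred′ : Prog pred
pred′ = prog-≗ (prec′ {S = λ _ y _ → y} Z′ (fst′ ∘′ snd′) ∘′ ⟨ Z′ , I′ ⟩′) prd
  where
  prd : ∀ n → prec (λ _ → 0) (λ _ y _ → y) (fst (pair 0 n)) (snd (pair 0 n)) ≡ pred n
  prd n rewrite fst-pair 0 n | snd-pair 0 n with n
  ... | zero  = refl
  ... | suc m = refl

_∸′_ : ∀ {F G} → Prog F → Prog G → Prog (λ x → F x ∸ G x)
_∸′_ = lift₂ {_∸_} (prog-≗ (prec′ {S = λ _ _ h → pred h} I′ (pred′ ∘′ snd′ ∘′ snd′)) (λ p → monus (fst p) (snd p)))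
  where
  monus : ∀ x y → prec (λ x → x) (λ _ _ h → pred h) x y ≡ x ∸ y
  monus x zero    = refl
  monus x (suc y) = trans (cong pred (monus x y)) (pred[m∸n]≡m∸[1+n] x y)

fold′ : ∀ {f F G} → Prog f → Prog F → Prog G → Prog (λ x → fold (G x) f (F x))
fold′ {f} pf pn px = lift₂ {λ a n → fold a f n}
  (prog-≗ (prec′ {S = λ _ _ h → f h} I′ (pf ∘′ snd′ ∘′ snd′)) (λ p → iter (fst p) (snd p))) px pn
  where
  iter : ∀ x y → prec (λ x → x) (λ _ _ h → f h) x y ≡ fold x f y
  iter x zero    = refl
  iter x (suc y) = cong f (iter x y)

bsum : (ℕ → ℕ) → ℕ → ℕ → ℕ
bsum F x zero    = 0
bsum F x (suc n) = bsum F x n + F (pair x n)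

bsum′ : ∀ {F A N} → Prog F → Prog A → Prog N → Prog (λ x → bsum F (A x) (N x))
bsum′ {F} pf = lift₂ {bsum F}
  (prog-≗ (prec′ {S = λ x y h → h + F (pair x y)} Z′ (snd′ ∘′ snd′ +′ pf ∘′ ⟨ fst′ , fst′ ∘′ snd′ ⟩′))
           (λ p → sums (fst p) (snd p)))
  where
  sums : ∀ x y → prec (λ _ → 0) (λ x y h → h + F (pair x y)) x y ≡ bsum F x y
  sums x zero    = refl
  sums x (suc y) = cong (_+ F (pair x y)) (sums x y)

2^′ : Prog (2 ^_)
2^′ = prog-≗ (fold′ (K′ 2 *′ I′) I′ (K′ 1)) doublings
  where
  doublings : ∀ n → fold 1 (2 *_) n ≡ 2 ^ n
  doublings zero    = refl
  doublings (suc n) = cong (2 *_) (doublings n)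

-- Lists of numbers are coded as  [] = 0 ,  E ∷ L = 1 + ⟨E , L⟩ .
cons : ℕ → ℕ → ℕ
cons E L = suc (pair E L)

hd tl : ℕ → ℕ
hd L = fst (pred L)
tl L = snd (pred L)

drop : ℕ → ℕ → ℕ
drop k L = fold L tl k

nth : ℕ → ℕ → ℕ
nth L k = hd (drop k L)

-- A trace entry  ⟨kind , e , x , v , r₁ , r₂⟩  claims  φ_e(x) = v  (kind 0) or that
-- φ_e(⟨x , y⟩) is positive for all y < v  (positive kind); r₁ and r₂ point to the
-- entries further down the trace that justify the claim.
entry : ℕ → ℕ → ℕ → ℕ → ℕ → ℕ → ℕ
entry k e x v r₁ r₂ = pair k (pair e (pair x (pair v (pair r₁ r₂))))

kind idx inp out ref₁ ref₂ : ℕ → ℕ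
kind E = fst E
idx  E = fst (snd E)
inp  E = fst (snd (snd E))
out  E = fst (snd (snd (snd E)))
ref₁ E = fst (snd (snd (snd (snd E))))
ref₂ E = snd (snd (snd (snd (snd E))))

-- Zero tests: arithmetic expressions that vanish exactly when a property holds.

dist : ℕ → ℕ → ℕ
dist a b = (a ∸ b) + (b ∸ a)

isZero : ℕ → ℕ
isZero zero    = 1
isZero (suc _) = 0

ifZero : ℕ → ℕ → ℕ → ℕ
ifZero s a b = isZero s * a + isZero (isZero s) * b

Case : ℕ → Set → Set → Set
Case zero    A B = A
Case (suc _) A B = B

Positive : ℕ → Set
Positive n = Σ ℕ λ u → n ≡ suc u

zero-cong : ∀ {a b} → a ≡ b → (a ≡ 0) ⇔ (b ≡ 0)
zero-cong a≡b = mk⇔ (trans (sym a≡b)) (trans a≡b)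

sum⇔ : ∀ {a b} {A B : Set} → (a ≡ 0) ⇔ A → (b ≡ 0) ⇔ B → (a + b ≡ 0) ⇔ (A × B)
sum⇔ {a} a⇔ b⇔ = (a⇔ ×-⇔ b⇔) ⇔-∘ mk⇔ (λ h → m+n≡0⇒m≡0 a h , m+n≡0⇒n≡0 a h) (λ { (refl , refl) → refl })

dist⇔ : ∀ a b → (dist a b ≡ 0) ⇔ (a ≡ b)
dist⇔ a b = mk⇔ (λ h → ≤-antisym (m∸n≡0⇒m≤n (m+n≡0⇒m≡0 _ h)) (m∸n≡0⇒m≤n (m+n≡0⇒n≡0 (a ∸ b) h)))
                (λ { refl → cong₂ _+_ (n∸n≡0 a) (n∸n≡0 a) })

isZero⇔ : ∀ n → (isZero n ≡ 0) ⇔ Positive n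
isZero⇔ zero    = mk⇔ (λ ()) (λ ())
isZero⇔ (suc n) = mk⇔ (λ _ → n , refl) (λ _ → refl)

ifZero-zero : ∀ a b → ifZero 0 a b ≡ a
ifZero-zero a b = trans (+-identityʳ (a + 0)) (+-identityʳ a)

ifZero-pos : ∀ {s} a b → Positive s → ifZero s a b ≡ b
ifZero-pos a b (u , refl) = +-identityʳ b

ifZero⇔ : ∀ s {a b} {A B : Set} → (a ≡ 0) ⇔ A → (b ≡ 0) ⇔ B → (ifZero s a b ≡ 0) ⇔ Case s A B
ifZero⇔ zero    {a} {b} a⇔ _ = a⇔ ⇔-∘ zero-cong (ifZero-zero a b)
ifZero⇔ (suc s) {a} {b} _ b⇔ = b⇔ ⇔-∘ zero-cong (ifZero-pos a b (s , refl))

dist-pos : ∀ {a b} → a ≢ b → Positive (dist a b)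
dist-pos {a} {b} a≢b with dist a b in eq
... | zero  = ⊥-elim (a≢b (Equivalence.to (dist⇔ a b) eq))
... | suc u = u , refl

select : ℕ → ℕ → (ℕ → ℕ) → ℕ
select zero    t X = 0
select (suc n) t X = select n t X + ifZero (dist t n) (X n) 0

select-beyond : ∀ n t X → n ≤ t → select n t X ≡ 0
select-beyond zero    t X _   = refl
select-beyond (suc n) t X n<t =
  cong₂ _+_ (select-beyond n t X (<⇒≤ n<t)) (ifZero-pos (X n) 0 (dist-pos (>⇒≢ n<t)))

select-at : ∀ n t X → t < n → select n t X ≡ X t
select-at (suc n) t X t<1+n with m<1+n⇒m<n∨m≡n t<1+n
... | inj₁ t<n  = trans (cong₂ _+_ (select-at n t X t<n) (ifZero-pos (X n) 0 (dist-pos (<⇒≢ t<n)))) (+-identityʳ (X t))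
... | inj₂ refl = begin
  select t t X + ifZero (dist t t) (X t) 0
    ≡⟨ cong₂ _+_ (select-beyond t t X ≤-refl) (cong (λ d → ifZero d (X t) 0) (dist-self t)) ⟩
  0 + ifZero 0 (X t) 0
    ≡⟨ ifZero-zero (X t) 0 ⟩
  X t
    ∎
  where open ≡-Reasoning
        dist-self : ∀ a → dist a a ≡ 0
        dist-self a = Equivalence.from (dist⇔ a a) refl

-- The tag of a code number, with all tags ≥ 9 (which denote cZ) identified with 9.
tag : ℕ → ℕ
tag e = 9 ⊓ fst e

tag<10 : ∀ e → tag e < 10
tag<10 e = s≤s (m⊓n≤m 9 (fst e))

Fields : ℕ → (k e x v : ℕ) → Set
Fields P k e x v = kind P ≡ k × idx P ≡ e × inp P ≡ x × out P ≡ v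

Claims : ℕ → ℕ → ℕ → Set
Claims P e x = kind P ≡ 0 × idx P ≡ e × inp P ≡ x

ClaimsPos : ℕ → ℕ → ℕ → ℕ → Set
ClaimsPos P e x y = Fields P 1 e x y

claim? : ℕ → ℕ → ℕ → ℕ
claim? P e x = kind P + (dist (idx P) e + dist (inp P) x)

claimPos? : ℕ → ℕ → ℕ → ℕ → ℕ
claimPos? P e x y = dist (kind P) 1 + (dist (idx P) e + (dist (inp P) x + dist (out P) y))

claim⇔ : ∀ P e x → (claim? P e x ≡ 0) ⇔ Claims P e x
claim⇔ P e x = sum⇔ (⇔-id _) (sum⇔ (dist⇔ _ e) (dist⇔ _ x))

claimPos⇔ : ∀ P e x y → (claimPos? P e x y ≡ 0) ⇔ ClaimsPos P e x y
claimPos⇔ P e x y = sum⇔ (dist⇔ _ 1) (sum⇔ (dist⇔ _ e) (sum⇔ (dist⇔ _ x) (dist⇔ _ y)))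

Step : ℕ → (e x v P₁ P₂ : ℕ) → Set
Step 0 e x v P₁ P₂ = v ≡ 0
Step 1 e x v P₁ P₂ = v ≡ suc x
Step 2 e x v P₁ P₂ = v ≡ x
Step 3 e x v P₁ P₂ = v ≡ fst x
Step 4 e x v P₁ P₂ = v ≡ snd x
Step 5 e x v P₁ P₂ = Claims P₁ (arg₁ e) x × Claims P₂ (arg₂ e) x × v ≡ pair (out P₁) (out P₂)
Step 6 e x v P₁ P₂ = Claims P₁ (arg₂ e) x × Claims P₂ (arg₁ e) (out P₁) × v ≡ out P₂
Step 7 e x v P₁ P₂ = Case (snd x)
  (Claims P₁ (arg₁ e) (fst x) × v ≡ out P₁)
  (Claims P₁ e (pair (fst x) (pred (snd x))) ×
   Claims P₂ (arg₂ e) (pair (fst x) (pair (pred (snd x)) (out P₁))) × v ≡ out P₂)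
Step 8 e x v P₁ P₂ = Claims P₁ (snd e) (pair x v) × out P₁ ≡ 0 × ClaimsPos P₂ (snd e) x v
Step (suc (suc (suc (suc (suc (suc (suc (suc (suc _))))))))) e x v P₁ P₂ = v ≡ 0

tagCheck : ℕ → (e x v P₁ P₂ : ℕ) → ℕ
tagCheck 0 e x v P₁ P₂ = v
tagCheck 1 e x v P₁ P₂ = dist v (suc x)
tagCheck 2 e x v P₁ P₂ = dist v x
tagCheck 3 e x v P₁ P₂ = dist v (fst x)
tagCheck 4 e x v P₁ P₂ = dist v (snd x)
tagCheck 5 e x v P₁ P₂ = claim? P₁ (arg₁ e) x + (claim? P₂ (arg₂ e) x + dist v (pair (out P₁) (out P₂)))
tagCheck 6 e x v P₁ P₂ = claim? P₁ (arg₂ e) x + (claim? P₂ (arg₁ e) (out P₁) + dist v (out P₂))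
tagCheck 7 e x v P₁ P₂ = ifZero (snd x)
  (claim? P₁ (arg₁ e) (fst x) + dist v (out P₁))
  (claim? P₁ e (pair (fst x) (pred (snd x))) +
   (claim? P₂ (arg₂ e) (pair (fst x) (pair (pred (snd x)) (out P₁))) + dist v (out P₂)))
tagCheck 8 e x v P₁ P₂ = claim? P₁ (snd e) (pair x v) + (out P₁ + claimPos? P₂ (snd e) x v)
tagCheck (suc (suc (suc (suc (suc (suc (suc (suc (suc _))))))))) e x v P₁ P₂ = v

tagCheck⇔ : ∀ i e x v P₁ P₂ → (tagCheck i e x v P₁ P₂ ≡ 0) ⇔ Step i e x v P₁ P₂
tagCheck⇔ 0 e x v P₁ P₂ = (⇔-id _)
tagCheck⇔ 1 e x v P₁ P₂ = dist⇔ v (suc x)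
tagCheck⇔ 2 e x v P₁ P₂ = dist⇔ v x
tagCheck⇔ 3 e x v P₁ P₂ = dist⇔ v (fst x)
tagCheck⇔ 4 e x v P₁ P₂ = dist⇔ v (snd x)
tagCheck⇔ 5 e x v P₁ P₂ = sum⇔ (claim⇔ P₁ _ x) (sum⇔ (claim⇔ P₂ _ x) (dist⇔ v _))
tagCheck⇔ 6 e x v P₁ P₂ = sum⇔ (claim⇔ P₁ _ x) (sum⇔ (claim⇔ P₂ _ _) (dist⇔ v _))
tagCheck⇔ 7 e x v P₁ P₂ = ifZero⇔ (snd x)
  (sum⇔ (claim⇔ P₁ _ _) (dist⇔ v _)) (sum⇔ (claim⇔ P₁ e _) (sum⇔ (claim⇔ P₂ _ _) (dist⇔ v _)))
tagCheck⇔ 8 e x v P₁ P₂ = sum⇔ (claim⇔ P₁ _ _) (sum⇔ (⇔-id _) (claimPos⇔ P₂ _ x v))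
tagCheck⇔ (suc (suc (suc (suc (suc (suc (suc (suc (suc _))))))))) e x v P₁ P₂ = (⇔-id _)

MinStep : (e x v P₁ P₂ : ℕ) → Set
MinStep e x v P₁ P₂ = Case v ⊤ (ClaimsPos P₁ e x (pred v) × Claims P₂ e (pair x (pred v)) × Positive (out P₂))

minCheck : (e x v P₁ P₂ : ℕ) → ℕ
minCheck e x v P₁ P₂ = ifZero v 0 (claimPos? P₁ e x (pred v) + (claim? P₂ e (pair x (pred v)) + isZero (out P₂)))

minCheck⇔ : ∀ e x v P₁ P₂ → (minCheck e x v P₁ P₂ ≡ 0) ⇔ MinStep e x v P₁ P₂
minCheck⇔ e x v P₁ P₂ = ifZero⇔ v (mk⇔ (λ _ → tt) (λ _ → refl))
  (sum⇔ (claimPos⇔ P₁ e x _) (sum⇔ (claim⇔ P₂ e _) (isZero⇔ (out P₂))))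

Justified : (k e x v P₁ P₂ : ℕ) → Set
Justified k e x v P₁ P₂ = Case k (Step (tag e) e x v P₁ P₂) (MinStep e x v P₁ P₂)

check : (k e x v P₁ P₂ : ℕ) → ℕ
check k e x v P₁ P₂ = ifZero k (select 10 (tag e) (λ i → tagCheck i e x v P₁ P₂)) (minCheck e x v P₁ P₂)

check⇔ : ∀ k e x v P₁ P₂ → (check k e x v P₁ P₂ ≡ 0) ⇔ Justified k e x v P₁ P₂
check⇔ k e x v P₁ P₂ = ifZero⇔ k
  (tagCheck⇔ (tag e) e x v P₁ P₂ ⇔-∘ zero-cong (select-at 10 (tag e) (λ i → tagCheck i e x v P₁ P₂) (tag<10 e)))
  (minCheck⇔ e x v P₁ P₂)

localCheck : ℕ → ℕ → ℕ
localCheck E R = check (kind E) (idx E) (inp E) (out E) (nth R (ref₁ E)) (nth R (ref₂ E))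

JustifiedIn : ℕ → ℕ → Set
JustifiedIn E R = Justified (kind E) (idx E) (inp E) (out E) (nth R (ref₁ E)) (nth R (ref₂ E))

localCheck⇔ : ∀ E R → (localCheck E R ≡ 0) ⇔ JustifiedIn E R
localCheck⇔ E R = check⇔ (kind E) (idx E) (inp E) (out E) (nth R (ref₁ E)) (nth R (ref₂ E))

hd′ : Prog hd
hd′ = fst′ ∘′ pred′

tl′ : Prog tl
tl′ = snd′ ∘′ pred′

nth′ : ∀ {L K} → Prog L → Prog K → Prog (λ q → nth (L q) (K q))
nth′ pl pk = hd′ ∘′ fold′ tl′ pk pl

kind′ : ∀ {E} → Prog E → Prog (λ q → kind (E q))
kind′ pE = fst′ ∘′ pE

idx′ : ∀ {E} → Prog E → Prog (λ q → idx (E q))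
idx′ pE = fst′ ∘′ snd′ ∘′ pE

inp′ : ∀ {E} → Prog E → Prog (λ q → inp (E q))
inp′ pE = fst′ ∘′ snd′ ∘′ snd′ ∘′ pE

out′ : ∀ {E} → Prog E → Prog (λ q → out (E q))
out′ pE = fst′ ∘′ snd′ ∘′ snd′ ∘′ snd′ ∘′ pE

ref₁′ : ∀ {E} → Prog E → Prog (λ q → ref₁ (E q))
ref₁′ pE = fst′ ∘′ snd′ ∘′ snd′ ∘′ snd′ ∘′ snd′ ∘′ pE

ref₂′ : ∀ {E} → Prog E → Prog (λ q → ref₂ (E q))
ref₂′ pE = snd′ ∘′ snd′ ∘′ snd′ ∘′ snd′ ∘′ snd′ ∘′ pE

dist′ : ∀ {F G} → Prog F → Prog G → Prog (λ q → dist (F q) (G q))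
dist′ pf pg = (pf ∸′ pg) +′ (pg ∸′ pf)

isZero′ : ∀ {F} → Prog F → Prog (λ q → isZero (F q))
isZero′ pf = prog-≗ (K′ 1 ∸′ I′) one∸ ∘′ pf
  where
  one∸ : ∀ n → 1 ∸ n ≡ isZero n
  one∸ zero    = refl
  one∸ (suc n) = 0∸n≡0 n

ifZero′ : ∀ {S A B} → Prog S → Prog A → Prog B → Prog (λ q → ifZero (S q) (A q) (B q))
ifZero′ ps pa pb = isZero′ ps *′ pa +′ isZero′ (isZero′ ps) *′ pb

select′ : ∀ n {T} {X : ℕ → ℕ → ℕ} → Prog T → (∀ i → Prog (X i)) → Prog (λ q → select n (T q) (λ i → X i q))
select′ zero    pt px = Z′
select′ (suc n) pt px = select′ n pt px +′ ifZero′ (dist′ pt (K′ n)) (px n) Z′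

claim?′ : ∀ {P E X} → Prog P → Prog E → Prog X → Prog (λ q → claim? (P q) (E q) (X q))
claim?′ pp pe px = kind′ pp +′ (dist′ (idx′ pp) pe +′ dist′ (inp′ pp) px)

claimPos?′ : ∀ {P E X Y} → Prog P → Prog E → Prog X → Prog Y → Prog (λ q → claimPos? (P q) (E q) (X q) (Y q))
claimPos?′ pp pe px py = dist′ (kind′ pp) (K′ 1) +′ (dist′ (idx′ pp) pe +′ (dist′ (inp′ pp) px +′ dist′ (out′ pp) py))

-- The tag 9 ⊓ t is computed as 9 ∸ (9 ∸ t).
m∸[m∸n]≡m⊓n : ∀ m n → m ∸ (m ∸ n) ≡ m ⊓ n
m∸[m∸n]≡m⊓n m n with ≤-total n m
... | inj₁ n≤m = trans (m∸[m∸n]≡n n≤m) (sym (m≥n⇒m⊓n≡n n≤m))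
... | inj₂ m≤n = trans (cong (m ∸_) (m≤n⇒m∸n≡0 m≤n)) (sym (m≤n⇒m⊓n≡m m≤n))

tag′ : ∀ {E} → Prog E → Prog (λ q → tag (E q))
tag′ {E} pe = prog-≗ (K′ 9 ∸′ (K′ 9 ∸′ fst′ ∘′ pe)) (λ q → m∸[m∸n]≡m⊓n 9 (fst (E q)))

module _ {E X V P₁ P₂ : ℕ → ℕ} (pe : Prog E) (px : Prog X) (pv : Prog V) (p₁ : Prog P₁) (p₂ : Prog P₂) where

  tagCheck′ : ∀ i → Prog (λ q → tagCheck i (E q) (X q) (V q) (P₁ q) (P₂ q))
  tagCheck′ 0 = pv
  tagCheck′ 1 = dist′ pv (S′ ∘′ px)
  tagCheck′ 2 = dist′ pv px
  tagCheck′ 3 = dist′ pv (fst′ ∘′ px)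
  tagCheck′ 4 = dist′ pv (snd′ ∘′ px)
  tagCheck′ 5 = claim?′ p₁ (fst′ ∘′ snd′ ∘′ pe) px +′
    (claim?′ p₂ (snd′ ∘′ snd′ ∘′ pe) px +′ dist′ pv ⟨ out′ p₁ , out′ p₂ ⟩′)
  tagCheck′ 6 = claim?′ p₁ (snd′ ∘′ snd′ ∘′ pe) px +′
    (claim?′ p₂ (fst′ ∘′ snd′ ∘′ pe) (out′ p₁) +′ dist′ pv (out′ p₂))
  tagCheck′ 7 = ifZero′ (snd′ ∘′ px)
    (claim?′ p₁ (fst′ ∘′ snd′ ∘′ pe) (fst′ ∘′ px) +′ dist′ pv (out′ p₁))
    (claim?′ p₁ pe ⟨ fst′ ∘′ px , pred′ ∘′ snd′ ∘′ px ⟩′ +′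
     (claim?′ p₂ (snd′ ∘′ snd′ ∘′ pe) ⟨ fst′ ∘′ px , ⟨ pred′ ∘′ snd′ ∘′ px , out′ p₁ ⟩′ ⟩′ +′ dist′ pv (out′ p₂)))
  tagCheck′ 8 = claim?′ p₁ (snd′ ∘′ pe) ⟨ px , pv ⟩′ +′ (out′ p₁ +′ claimPos?′ p₂ (snd′ ∘′ pe) px pv)
  tagCheck′ (suc (suc (suc (suc (suc (suc (suc (suc (suc _))))))))) = pv

  minCheck′ : Prog (λ q → minCheck (E q) (X q) (V q) (P₁ q) (P₂ q))
  minCheck′ = ifZero′ pv Z′
    (claimPos?′ p₁ pe px (pred′ ∘′ pv) +′ (claim?′ p₂ pe ⟨ px , pred′ ∘′ pv ⟩′ +′ isZero′ (out′ p₂)))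

  check′ : ∀ {K} → Prog K → Prog (λ q → check (K q) (E q) (X q) (V q) (P₁ q) (P₂ q))
  check′ pk = ifZero′ pk (select′ 10 (tag′ pe) tagCheck′) minCheck′

localCheck′ : Prog (λ q → localCheck (fst q) (snd q))
localCheck′ = check′ (idx′ fst′) (inp′ fst′) (out′ fst′) (nth′ snd′ (ref₁′ fst′)) (nth′ snd′ (ref₂′ fst′)) (kind′ fst′)

entryCheck : ℕ → ℕ
entryCheck q = localCheck (nth (fst q) (snd q)) (drop (suc (snd q)) (fst q))

traceCheck : ℕ → ℕ
traceCheck L = bsum entryCheck L L

traceCheck′ : Prog traceCheck
traceCheck′ = bsum′ (lift₂ {localCheck} localCheck′ (nth′ fst′ snd′) (fold′ tl′ (S′ ∘′ snd′) fst′)) I′ I′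

-- Kleene's T predicate: T e z L = 0 iff L is a valid trace whose head records φ_e(z).
T : ℕ → ℕ → ℕ → ℕ
T e z L = traceCheck L + claim? (hd L) e z

T′ : ∀ {E Z L} → Prog E → Prog Z → Prog L → Prog (λ q → T (E q) (Z q) (L q))
T′ pe pz pl = traceCheck′ ∘′ pl +′ claim?′ (hd′ ∘′ pl) pe pz

PositiveBelow : ℕ → ℕ → ℕ → Set
PositiveBelow e x v = ∀ y → y < v → Σ ℕ λ w → e ⟦ pair x y ⟧φ⇓ suc w

Holds : ℕ → ℕ → ℕ → ℕ → Set
Holds k e x v = Case k (e ⟦ x ⟧φ⇓ v) (PositiveBelow e x v)

HoldsE : ℕ → Set
HoldsE E = Holds (kind E) (idx E) (inp E) (out E)

case-zero : ∀ {k} {A B : Set} → k ≡ 0 → Case k A B → A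
case-zero refl a = a

case-suc : ∀ {k j} {A B : Set} → k ≡ suc j → Case k A B → B
case-suc refl b = b

use-claim : ∀ P {e x} → HoldsE P → Claims P e x → e ⟦ x ⟧φ⇓ out P
use-claim P h (k≡0 , refl , refl) = case-zero k≡0 h

use-pos : ∀ P {e x y} → HoldsE P → ClaimsPos P e x y → PositiveBelow e x y
use-pos P h (k≡1 , refl , refl , refl) = case-suc k≡1 h

run-tag : ∀ e {t x v} → fst e ≡ t → shape t e ⟦ x ⟧⇓ v → e ⟦ x ⟧φ⇓ v
run-tag e eq = subst (λ c → c ⟦ _ ⟧⇓ _) (sym (decode-tag e eq))

rec-holds : ∀ e x v P₁ P₂ → decode e ≡ shape 7 e → HoldsE P₁ → HoldsE P₂ → Step 7 e x v P₁ P₂ → shape 7 e ⟦ x ⟧⇓ v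
rec-holds e x v P₁ P₂ dec h₁ h₂ s with snd x in eq
... | zero  with c₁ , refl ← s = evRec0 (cong (fst x ,_) eq) (use-claim P₁ h₁ c₁)
... | suc y with c₁ , c₂ , refl ← s =
  evRecS (cong (fst x ,_) eq) (subst (λ c → c ⟦ _ ⟧⇓ _) dec (use-claim P₁ h₁ c₁)) (use-claim P₂ h₂ c₂)

step-holds : ∀ e x v P₁ P₂ → HoldsE P₁ → HoldsE P₂ → Step (tag e) e x v P₁ P₂ → e ⟦ x ⟧φ⇓ v
step-holds e x v P₁ P₂ h₁ h₂ s with fst e in eq
... | 0 = run-tag e eq (subst (cZ ⟦ x ⟧⇓_) (sym s) evZ)
... | 1 = run-tag e eq (subst (cS ⟦ x ⟧⇓_) (sym s) evS)
... | 2 = run-tag e eq (subst (cI ⟦ x ⟧⇓_) (sym s) evI)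
... | 3 = run-tag e eq (subst (cFst ⟦ x ⟧⇓_) (sym s) evFst)
... | 4 = run-tag e eq (subst (cSnd ⟦ x ⟧⇓_) (sym s) evSnd)
... | 5 with c₁ , c₂ , refl ← s = run-tag e eq (evPair (use-claim P₁ h₁ c₁) (use-claim P₂ h₂ c₂))
... | 6 with c₁ , c₂ , refl ← s = run-tag e eq (evComp (use-claim P₁ h₁ c₁) (use-claim P₂ h₂ c₂))
... | 7 = run-tag e eq (rec-holds e x v P₁ P₂ (decode-tag e eq) h₁ h₂ s)
... | 8 with c₁ , o≡0 , c₂ ← s =
  run-tag e eq (evMu (subst (_ ⟦ pair x v ⟧⇓_) o≡0 (use-claim P₁ h₁ c₁)) (use-pos P₂ h₂ c₂))
... | suc (suc (suc (suc (suc (suc (suc (suc (suc _)))))))) = run-tag e eq (subst (cZ ⟦ x ⟧⇓_) (sym s) evZ)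

minStep-holds : ∀ e x v P₁ P₂ → HoldsE P₁ → HoldsE P₂ → MinStep e x v P₁ P₂ → PositiveBelow e x v
minStep-holds e x zero    P₁ P₂ h₁ h₂ _ y ()
minStep-holds e x (suc w) P₁ P₂ h₁ h₂ (c₁ , c₂ , u , o≡1+u) y y<1+w with m<1+n⇒m<n∨m≡n y<1+w
... | inj₁ y<w  = use-pos P₁ h₁ c₁ y y<w
... | inj₂ refl = u , subst (_ ⟦ pair x y ⟧⇓_) o≡1+u (use-claim P₂ h₂ c₂)

justified-holds : ∀ k e x v P₁ P₂ → HoldsE P₁ → HoldsE P₂ → Justified k e x v P₁ P₂ → Holds k e x v
justified-holds zero    e x v P₁ P₂ h₁ h₂ j = step-holds e x v P₁ P₂ h₁ h₂ j
justified-holds (suc _) e x v P₁ P₂ h₁ h₂ j = minStep-holds e x v P₁ P₂ h₁ h₂ j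

justifiedIn-holds : ∀ E R → HoldsE (nth R (ref₁ E)) → HoldsE (nth R (ref₂ E)) → JustifiedIn E R → HoldsE E
justifiedIn-holds E R = justified-holds (kind E) (idx E) (inp E) (out E) (nth R (ref₁ E)) (nth R (ref₂ E))

Valid : ℕ → Set
Valid L = ∀ k → JustifiedIn (nth L k) (drop (suc k) L)

drop-+ : ∀ m n L → drop (m + n) L ≡ drop m (drop n L)
drop-+ m n L = fold-+ L tl m

-- Dropping shortens the list, so beyond its code a list is empty.
drop≤ : ∀ k L → drop k L ≤ L ∸ k
drop≤ zero    L = ≤-refl
drop≤ (suc k) L = begin
  tl (drop k L)   ≤⟨ snd≤ (pred (drop k L)) ⟩
  pred (drop k L) ≤⟨ pred-mono-≤ (drop≤ k L) ⟩
  pred (L ∸ k)    ≡⟨ pred[m∸n]≡m∸[1+n] L k ⟩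
  L ∸ suc k       ∎
  where open ≤-Reasoning

drop-beyond : ∀ k L → L ≤ k → drop k L ≡ 0
drop-beyond k L L≤k = n≤0⇒n≡0 (≤-trans (drop≤ k L) (≤-reflexive (m≤n⇒m∸n≡0 L≤k)))

-- Every entry of a valid trace holds: induction on the length of the trace below the entry.
valid-holds : ∀ L → Valid L → ∀ k → HoldsE (nth L k)
valid-holds L V k = below {L} {k} (m≤n+m L k)
  where
  below : ∀ {d k} → L ≤ k + d → HoldsE (nth L k)
  below {zero}  {k} L≤k rewrite drop-beyond k L (≤-trans L≤k (≤-reflexive (+-identityʳ k))) = evZ
  below {suc d} {k} L≤k+1+d =
    justifiedIn-holds (nth L k) R (premise (ref₁ (nth L k))) (premise (ref₂ (nth L k))) (V k)
    where
    R : ℕ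
    R = drop (suc k) L
    premise : ∀ r → HoldsE (nth R r)
    premise r = subst HoldsE (cong hd (drop-+ r (suc k) L)) (below {d} {r + suc k} (begin
      L               ≤⟨ L≤k+1+d ⟩
      k + suc d       ≡⟨ +-suc k d ⟩
      suc k + d       ≤⟨ +-monoˡ-≤ d (m≤n+m (suc k) r) ⟩
      (r + suc k) + d ∎))
      where open ≤-Reasoning

bsum⇔ : ∀ F x n → (bsum F x n ≡ 0) ⇔ (∀ k → k < n → F (pair x k) ≡ 0)
bsum⇔ F x n = mk⇔ (to n) (from n)
  where
  to : ∀ n → bsum F x n ≡ 0 → ∀ k → k < n → F (pair x k) ≡ 0
  to (suc n) h k k<1+n with m<1+n⇒m<n∨m≡n k<1+n
  ... | inj₁ k<n  = to n (m+n≡0⇒m≡0 (bsum F x n) h) k k<n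
  ... | inj₂ refl = m+n≡0⇒n≡0 (bsum F x n) h
  from : ∀ n → (∀ k → k < n → F (pair x k) ≡ 0) → bsum F x n ≡ 0
  from zero    _ = refl
  from (suc n) h = cong₂ _+_ (from n (λ k k<n → h k (m<n⇒m<1+n k<n))) (h n ≤-refl)

entryCheck-pair : ∀ L k → entryCheck (pair L k) ≡ localCheck (nth L k) (drop (suc k) L)
entryCheck-pair L k rewrite fst-pair L k | snd-pair L k = refl

-- The trace check vanishes iff the trace is valid; past the end of L the entry 0 is trivially justified.
traceCheck⇔ : ∀ L → (traceCheck L ≡ 0) ⇔ Valid L
traceCheck⇔ L = mk⇔ to from
  where
  entry⇔ : ∀ k → (entryCheck (pair L k) ≡ 0) ⇔ JustifiedIn (nth L k) (drop (suc k) L)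
  entry⇔ k = localCheck⇔ (nth L k) (drop (suc k) L) ⇔-∘ zero-cong (entryCheck-pair L k)
  to : traceCheck L ≡ 0 → Valid L
  to h k with k <? L
  ... | yes k<L = Equivalence.to (entry⇔ k) (Equivalence.to (bsum⇔ entryCheck L L) h k k<L)
  ... | no  k≮L rewrite drop-beyond k L (≮⇒≥ k≮L) = refl
  from : Valid L → traceCheck L ≡ 0
  from V = Equivalence.from (bsum⇔ entryCheck L L) (λ k _ → Equivalence.from (entry⇔ k) (V k))


T-sound : ∀ e z L → T e z L ≡ 0 → e ⟦ z ⟧φ⇓ out (hd L)
T-sound e z L h = use-claim (hd L)
  (valid-holds L (Equivalence.to (traceCheck⇔ L) (m+n≡0⇒m≡0 _ h)) 0)
  (Equivalence.to (claim⇔ (hd L) e z) (m+n≡0⇒n≡0 (traceCheck L) h))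

hd-cons : ∀ E L → hd (cons E L) ≡ E
hd-cons E L = fst-pair E L

tl-cons : ∀ E L → tl (cons E L) ≡ L
tl-cons E L = snd-pair E L

drop-suc : ∀ k L → drop (suc k) L ≡ drop k (tl L)
drop-suc k L = trans (cong (λ n → drop n L) (+-comm 1 k)) (drop-+ k 1 L)

module _ (k e x v r₁ r₂ : ℕ) where
  private
    E : ℕ
    E = entry k e x v r₁ r₂
    tail₁ : snd E ≡ pair e (pair x (pair v (pair r₁ r₂)))
    tail₁ = snd-pair k _
    tail₂ : snd (snd E) ≡ pair x (pair v (pair r₁ r₂))
    tail₂ = trans (cong snd tail₁) (snd-pair e _)
    tail₃ : snd (snd (snd E)) ≡ pair v (pair r₁ r₂)
    tail₃ = trans (cong snd tail₂) (snd-pair x _)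
    tail₄ : snd (snd (snd (snd E))) ≡ pair r₁ r₂
    tail₄ = trans (cong snd tail₃) (snd-pair v _)

  entry-fields : Fields E k e x v
  entry-fields = fst-pair k _ , trans (cong fst tail₁) (fst-pair e _) ,
                 trans (cong fst tail₂) (fst-pair x _) , trans (cong fst tail₃) (fst-pair v _)

  entry-ref₁ : ref₁ E ≡ r₁
  entry-ref₁ = trans (cong fst tail₄) (fst-pair r₁ r₂)

  entry-ref₂ : ref₂ E ≡ r₂
  entry-ref₂ = trans (cong snd tail₄) (snd-pair r₁ r₂)

justified-entry : ∀ k e x v r₁ r₂ R → Justified k e x v (nth R r₁) (nth R r₂) → JustifiedIn (entry k e x v r₁ r₂) R
justified-entry k e x v r₁ r₂ R j with entry-fields k e x v r₁ r₂
... | k≡ , e≡ , x≡ , v≡ rewrite k≡ | e≡ | x≡ | v≡ | entry-ref₁ k e x v r₁ r₂ | entry-ref₂ k e x v r₁ r₂ = j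

push : ∀ E L → Valid L → JustifiedIn E L → Valid (cons E L)
push E L V j zero    rewrite hd-cons E L | tl-cons E L = j
push E L V j (suc k) rewrite drop-suc k (cons E L) | tl-cons E L = V k

Extends : ℕ → ℕ → Set
Extends L′ L = Σ ℕ λ p → drop p L′ ≡ L

extends-trans : ∀ {L₂ L₁ L} → Extends L₂ L₁ → Extends L₁ L → Extends L₂ L
extends-trans {L₂} (p₂ , q₂) (p₁ , q₁) = p₁ + p₂ , trans (drop-+ p₁ p₂ L₂) (trans (cong (drop p₁) q₂) q₁)

still-there : ∀ {L₂ L₁ k e x v} (X : Extends L₂ L₁) → Fields (hd L₁) k e x v → Fields (nth L₂ (proj₁ X)) k e x v
still-there (p , q) = subst (λ P → Fields P _ _ _ _) (sym (cong hd q))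

Grows : ℕ → (ℕ → Set) → Set
Grows L Head = Σ ℕ λ L′ → Valid L′ × Head (hd L′) × Extends L′ L

push-entry : ∀ {L L₂} k e x v r₁ r₂ → Valid L₂ → Extends L₂ L →
             Justified k e x v (nth L₂ r₁) (nth L₂ r₂) → Grows L (λ P → Fields P k e x v)
push-entry {L} {L₂} k e x v r₁ r₂ V₂ (p , q) j =
  cons E L₂ , push E L₂ V₂ (justified-entry k e x v r₁ r₂ L₂ j) ,
  subst (λ P → Fields P k e x v) (sym (hd-cons E L₂)) (entry-fields k e x v r₁ r₂) ,
  suc p , trans (drop-suc p (cons E L₂)) (trans (cong (drop p) (tl-cons E L₂)) q)
  where
  E : ℕ
  E = entry k e x v r₁ r₂

claims : ∀ P {e x v} → Fields P 0 e x v → Claims P e x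
claims P (k≡0 , e≡ , x≡ , _) = k≡0 , e≡ , x≡

output : ∀ P {k e x v} → Fields P k e x v → out P ≡ v
output P (_ , _ , _ , v≡) = v≡

at-tag : ∀ e {t x v P₁ P₂} → fst e ≡ t → Step (9 ⊓ t) e x v P₁ P₂ → Step (tag e) e x v P₁ P₂
at-tag e refl s = s

Recordable : ℕ → ℕ → ℕ → Set
Recordable e x v = ∀ L → Valid L → Grows L (λ P → Fields P 0 e x v)

PosRecordable : ℕ → ℕ → ℕ → Set
PosRecordable e x y = ∀ L → Valid L → Grows L (λ P → Fields P 1 e x y)

record-axiom : ∀ {e x v} → (∀ L → Step (tag e) e x v (nth L 0) (nth L 0)) → Recordable e x v
record-axiom {e} {x} {v} step L V = push-entry 0 e x v 0 0 V (0 , refl) (step L)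

record-pair : ∀ {e x a b} → fst e ≡ 5 → Recordable (arg₁ e) x a → Recordable (arg₂ e) x b → Recordable e x (pair a b)
record-pair {e} {x} {a} {b} t≡5 rec₁ rec₂ L V
  with L₁ , V₁ , H₁ , X₁ ← rec₁ L V
  with L₂ , V₂ , H₂ , X₂ ← rec₂ L₁ V₁ =
  push-entry 0 e x (pair a b) (proj₁ X₂) 0 V₂ (extends-trans X₂ X₁)
    (at-tag e t≡5 (claims P₁ H₁′ , claims (hd L₂) H₂ , cong₂ pair (sym (output P₁ H₁′)) (sym (output (hd L₂) H₂))))
  where
  P₁ : ℕ
  P₁ = nth L₂ (proj₁ X₂)
  H₁′ : Fields P₁ 0 (arg₁ e) x a
  H₁′ = still-there X₂ H₁

record-comp : ∀ {e x y v} → fst e ≡ 6 → Recordable (arg₂ e) x y → Recordable (arg₁ e) y v → Recordable e x v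
record-comp {e} {x} {y} {v} t≡6 rec₁ rec₂ L V
  with L₁ , V₁ , H₁ , X₁ ← rec₁ L V
  with L₂ , V₂ , H₂ , X₂ ← rec₂ L₁ V₁ =
  push-entry 0 e x v (proj₁ X₂) 0 V₂ (extends-trans X₂ X₁) (at-tag e t≡6
    (claims P₁ H₁′ , subst (Claims (hd L₂) (arg₁ e)) (sym (output P₁ H₁′)) (claims (hd L₂) H₂) ,
     sym (output (hd L₂) H₂)))
  where
  P₁ : ℕ
  P₁ = nth L₂ (proj₁ X₂)
  H₁′ : Fields P₁ 0 (arg₂ e) x y
  H₁′ = still-there X₂ H₁

record-rec₀ : ∀ {e x x₀ v} → fst e ≡ 7 → unpair x ≡ (x₀ , 0) → Recordable (arg₁ e) x₀ v → Recordable e x v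
record-rec₀ {e} {x} {x₀} {v} t≡7 u rec L V with L₁ , V₁ , H₁ , X₁ ← rec L V =
  push-entry 0 e x v 0 0 V₁ X₁ (at-tag e t≡7 (rec-zero (cong proj₂ u)))
  where
  rec-zero : snd x ≡ 0 → Step 7 e x v (hd L₁) (hd L₁)
  rec-zero s≡0 rewrite s≡0 | cong proj₁ u = claims (hd L₁) H₁ , sym (output (hd L₁) H₁)

record-recS : ∀ {e x x₀ y h v} → fst e ≡ 7 → unpair x ≡ (x₀ , suc y) →
              Recordable e (pair x₀ y) h → Recordable (arg₂ e) (pair x₀ (pair y h)) v → Recordable e x v
record-recS {e} {x} {x₀} {y} {h} {v} t≡7 u rec₁ rec₂ L V
  with L₁ , V₁ , H₁ , X₁ ← rec₁ L V
  with L₂ , V₂ , H₂ , X₂ ← rec₂ L₁ V₁ =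
  push-entry 0 e x v (proj₁ X₂) 0 V₂ (extends-trans X₂ X₁) (at-tag e t≡7 (rec-suc (cong proj₂ u)))
  where
  P₁ : ℕ
  P₁ = nth L₂ (proj₁ X₂)
  H₁′ : Fields P₁ 0 e (pair x₀ y) h
  H₁′ = still-there X₂ H₁
  rec-suc : snd x ≡ suc y → Step 7 e x v P₁ (hd L₂)
  rec-suc s≡1+y rewrite s≡1+y | cong proj₁ u =
    claims P₁ H₁′ ,
    subst (λ w → Claims (hd L₂) (arg₂ e) (pair x₀ (pair y w))) (sym (output P₁ H₁′)) (claims (hd L₂) H₂) ,
    sym (output (hd L₂) H₂)

record-positive : ∀ {e x} y → (∀ k → k < y → Σ ℕ λ w → Recordable e (pair x k) (suc w)) → PosRecordable e x y
record-positive {e} {x} zero    _   L V = push-entry 1 e x 0 0 0 V (0 , refl) tt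
record-positive {e} {x} (suc y) pos L V
  with Lₖ , Vₖ , Hₖ , Xₖ ← record-positive y (λ k k<y → pos k (m<n⇒m<1+n k<y)) L V
  with w , rec ← pos y ≤-refl
  with L′ , V′ , H′ , X′ ← rec Lₖ Vₖ =
  push-entry 1 e x (suc y) (proj₁ X′) 0 V′ (extends-trans X′ Xₖ)
    (still-there X′ Hₖ , claims (hd L′) H′ , w , output (hd L′) H′)

record-mu : ∀ {e x y} → fst e ≡ 8 → Recordable (snd e) (pair x y) 0 → PosRecordable (snd e) x y → Recordable e x y
record-mu {e} {x} {y} t≡8 rec₀ pos L V
  with L₁ , V₁ , H₁ , X₁ ← rec₀ L V
  with L₂ , V₂ , H₂ , X₂ ← pos L₁ V₁ =
  push-entry 0 e x y (proj₁ X₂) 0 V₂ (extends-trans X₂ X₁) (at-tag e t≡8 (claims P₁ H₁′ , output P₁ H₁′ , H₂))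
  where
  P₁ : ℕ
  P₁ = nth L₂ (proj₁ X₂)
  H₁′ : Fields P₁ 0 (snd e) (pair x y) 0
  H₁′ = still-there X₂ H₁

complete : ∀ {c x v} → c ⟦ x ⟧⇓ v → ∀ e → decode e ≡ c → Recordable e x v
complete evZ   e dec = record-axiom (λ _ → zero-step (decode-inv e dec))
  where
  zero-step : ∀ {x P₁ P₂} → (fst e ≡ 0 ⊎ 9 ≤ fst e) → Step (tag e) e x 0 P₁ P₂
  zero-step (inj₁ t≡0) = at-tag e t≡0 refl
  zero-step (inj₂ 9≤t) = subst (λ t → Step t e _ 0 _ _) (sym (m≤n⇒m⊓n≡m 9≤t)) refl
complete evS   e dec = record-axiom (λ _ → at-tag e (decode-inv e dec) refl)
complete evI   e dec = record-axiom (λ _ → at-tag e (decode-inv e dec) refl)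
complete evFst e dec = record-axiom (λ _ → at-tag e (decode-inv e dec) refl)
complete evSnd e dec = record-axiom (λ _ → at-tag e (decode-inv e dec) refl)
complete (evPair d₁ d₂) e dec with t≡5 , dec₁ , dec₂ ← decode-inv e dec =
  record-pair t≡5 (complete d₁ (arg₁ e) dec₁) (complete d₂ (arg₂ e) dec₂)
complete (evComp d₁ d₂) e dec with t≡6 , dec₁ , dec₂ ← decode-inv e dec =
  record-comp t≡6 (complete d₁ (arg₂ e) dec₂) (complete d₂ (arg₁ e) dec₁)
complete (evRec0 u d) e dec with t≡7 , dec₁ , _ ← decode-inv e dec =
  record-rec₀ t≡7 u (complete d (arg₁ e) dec₁)
complete (evRecS u d₁ d₂) e dec with t≡7 , _ , dec₂ ← decode-inv e dec =
  record-recS t≡7 u (complete d₁ e dec) (complete d₂ (arg₂ e) dec₂)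
complete (evMu {y = y} d₀ below) e dec with t≡8 , dec₀ ← decode-inv e dec =
  record-mu t≡8 (complete d₀ (snd e) dec₀)
    (record-positive y (λ k k<y → proj₁ (below k k<y) , complete (proj₂ (below k k<y)) (snd e) dec₀))

T-complete : ∀ e z v → e ⟦ z ⟧φ⇓ v → Σ ℕ λ L → T e z L ≡ 0 × out (hd L) ≡ v
T-complete e z v d with L , V , H , _ ← complete d e refl 0 (Equivalence.to (traceCheck⇔ 0) refl) =
  L , cong₂ _+_ (Equivalence.from (traceCheck⇔ L) V) (Equivalence.from (claim⇔ (hd L) e z) (claims (hd L) H)) ,
  output (hd L) H

search : ∀ (g : ℕ → ℕ) n → (Σ ℕ λ m → g m ≡ 0 × (∀ k → k < m → Positive (g k))) ⊎ (∀ k → k < n → Positive (g k))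
search g zero = inj₂ (λ _ ())
search g (suc n) with search g n
... | inj₁ found = inj₁ found
... | inj₂ none with g n in eq
...   | zero  = inj₁ (n , eq , none)
...   | suc w = inj₂ λ k k<1+n → [ none k , (λ { refl → w , eq }) ]′ (m<1+n⇒m<n∨m≡n k<1+n)

least-zero : ∀ (g : ℕ → ℕ) n → g n ≡ 0 → Σ ℕ λ m → g m ≡ 0 × (∀ k → k < m → Positive (g k))
least-zero g n gn≡0 with search g (suc n)
... | inj₁ found = found
... | inj₂ none with () ← trans (sym gn≡0) (proj₂ (none n ≤-refl))

mu-halts⇔ : ∀ {F} (p : Prog F) z → (Σ ℕ λ v → cMu (code p) ⟦ z ⟧⇓ v) ⇔ (Σ ℕ λ w → F (pair z w) ≡ 0)
mu-halts⇔ {F} p z = mk⇔ to from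
  where
  to : (Σ ℕ λ v → cMu (code p) ⟦ z ⟧⇓ v) → Σ ℕ λ w → F (pair z w) ≡ 0
  to (v , evMu d₀ _) = v , sym (⇓-det d₀ (runs p (pair z v)))
  from : (Σ ℕ λ w → F (pair z w) ≡ 0) → Σ ℕ λ v → cMu (code p) ⟦ z ⟧⇓ v
  from (w , h) with m , Fm≡0 , below ← least-zero (λ y → F (pair z y)) w h =
    m , evMu (subst (code p ⟦ pair z m ⟧⇓_) Fm≡0 (runs p (pair z m)))
             (λ k k<m → proj₁ (below k k<m) , subst (code p ⟦ pair z k ⟧⇓_) (proj₂ (below k k<m)) (runs p (pair z k)))

m∸n≡0⇔ : ∀ m n → (m ∸ n ≡ 0) ⇔ (m ≤ n)
m∸n≡0⇔ m n = mk⇔ m∸n≡0⇒m≤n m≤n⇒m∸n≡0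

*≡0⇔ : ∀ m n → (m * n ≡ 0) ⇔ (m ≡ 0 ⊎ n ≡ 0)
*≡0⇔ m n = mk⇔ (m*n≡0⇒m≡0∨n≡0 m) [ (λ { refl → refl }) , (λ { refl → *-zeroʳ m }) ]′

-- The blocks of index e:  I_e = [start e , start e + e + 1)  and  K_e = [start e + e + 1 , start (e + 1)) .
start : ℕ → ℕ
start e = e * suc e

-- Q e ⟨z , L⟩ = 0  iff  L traces φ_e(z) and z lies beyond the blocks of e.
Q : ℕ → ℕ → ℕ
Q e u = T e (fst u) (snd u) + (start (suc e) ∸ fst u)

-- u is the least zero of Q e, and z is its first component: z is the element of W_e
-- beyond the blocks of e that the enumeration finds first.
First : ℕ → ℕ → ℕ → Set
First e u z = Q e u ≡ 0 × fst u ≡ z × (∀ k → k < u → Positive (Q e k))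

Zeroed : ℕ → ℕ → ℕ → Set
Zeroed e u z = start e ≤ z × z < start e + suc e × T e z u ≡ 0 × out (hd u) ≡ 0

firstCheck zeroedCheck : ℕ → ℕ → ℕ → ℕ
firstCheck z e u = Q e u + (dist (fst u) z + bsum (λ q → isZero (Q (fst q) (snd q))) e u)
zeroedCheck z e u = (start e ∸ z) + ((suc z ∸ (start e + suc e)) + (T e z u + out (hd u)))

positive-below⇔ : ∀ (G : ℕ → ℕ → ℕ) e u →
  (bsum (λ q → isZero (G (fst q) (snd q))) e u ≡ 0) ⇔ (∀ k → k < u → Positive (G e k))
positive-below⇔ G e u = mk⇔
  (λ h k k<u → Equivalence.to (isZero⇔ (G e k))
     (trans (cong isZero (sym (G-pair k))) (Equivalence.to (bsum⇔ tests e u) h k k<u)))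
  (λ h → Equivalence.from (bsum⇔ tests e u) λ k k<u →
     trans (cong isZero (G-pair k)) (Equivalence.from (isZero⇔ (G e k)) (h k k<u)))
  where
  tests : ℕ → ℕ
  tests q = isZero (G (fst q) (snd q))
  G-pair : ∀ k → G (fst (pair e k)) (snd (pair e k)) ≡ G e k
  G-pair k = cong₂ G (fst-pair e k) (snd-pair e k)

first⇔ : ∀ z e u → (firstCheck z e u ≡ 0) ⇔ First e u z
first⇔ z e u = sum⇔ (⇔-id _) (sum⇔ (dist⇔ (fst u) z) (positive-below⇔ Q e u))

zeroed⇔ : ∀ z e u → (zeroedCheck z e u ≡ 0) ⇔ Zeroed e u z
zeroed⇔ z e u = sum⇔ (m∸n≡0⇔ _ z) (sum⇔ (m∸n≡0⇔ (suc z) _) (sum⇔ (⇔-id _) (⇔-id _)))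

search-A : ℕ → ℕ
search-A q = firstCheck (fst q) (arg₁ q) (arg₂ q) * zeroedCheck (fst q) (arg₁ q) (arg₂ q)

InA : ℕ → Set
InA z = Σ ℕ λ e → Σ ℕ λ u → First e u z ⊎ Zeroed e u z

search-A⇔ : ∀ z e u → (search-A (pair z (pair e u)) ≡ 0) ⇔ (First e u z ⊎ Zeroed e u z)
search-A⇔ z e u = (first⇔ z e u ⊎-⇔ zeroed⇔ z e u) ⇔-∘ (*≡0⇔ _ _ ⇔-∘ zero-cong at)
  where
  at : search-A (pair z (pair e u)) ≡ firstCheck z e u * zeroedCheck z e u
  at rewrite fst-pair z (pair e u) | arg₁-pair z e u | arg₂-pair z e u = refl

start′ : ∀ {E} → Prog E → Prog (λ q → start (E q))
start′ pe = pe *′ S′ ∘′ pe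

Q′ : ∀ {E U} → Prog E → Prog U → Prog (λ q → Q (E q) (U q))
Q′ pe pu = T′ pe (fst′ ∘′ pu) (snd′ ∘′ pu) +′ (start′ (S′ ∘′ pe) ∸′ fst′ ∘′ pu)

index-halts⇔ : ∀ n {c} → decode n ≡ c → ∀ z → Halts n z ⇔ (Σ ℕ λ v → c ⟦ z ⟧⇓ v)
index-halts⇔ n refl z = ⇔-id _

-- The simple, D-w.e.u. set A is the domain of the minimisation of search-A.
-- Opaque, so that the (huge) code is never unfolded during type checking.
opaque
  search-A′ : Prog search-A
  search-A′ =
    (Q′ e′ u′ +′ (dist′ (fst′ ∘′ u′) z′ +′ bsum′ (isZero′ (Q′ fst′ snd′)) e′ u′)) *′
    ((start′ e′ ∸′ z′) +′ ((S′ ∘′ z′ ∸′ (start′ e′ +′ S′ ∘′ e′)) +′ (T′ e′ z′ u′ +′ out′ (hd′ ∘′ u′))))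
    where
    z′ : Prog fst
    z′ = fst′
    e′ : Prog arg₁
    e′ = fst′ ∘′ snd′
    u′ : Prog arg₂
    u′ = snd′ ∘′ snd′

  A-index : Σ ℕ λ n → decode n ≡ cMu (code search-A′)
  A-index = encode (cMu (code search-A′)) , decode-encode (cMu (code search-A′))

A : Pred
A = Halts (proj₁ A-index)

witness⇔ : ∀ z → (Σ ℕ λ w → search-A (pair z w) ≡ 0) ⇔ InA z
witness⇔ z = mk⇔
  (λ (w , h) → fst w , snd w , Equivalence.to (search-A⇔ z (fst w) (snd w))
                 (subst (λ w → search-A (pair z w) ≡ 0) (sym (pair-fst-snd w)) h))
  (λ (e , u , s) → pair e u , Equivalence.from (search-A⇔ z e u) s)

A⇔ : ∀ z → A z ⇔ InA z
A⇔ z = witness⇔ z ⇔-∘ (mu-halts⇔ search-A′ z ⇔-∘ index-halts⇔ (proj₁ A-index) (proj₂ A-index) z)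

-- Arithmetic of the blocks: I_e, K_e, I_{e+1}, ... are consecutive intervals of length e + 1, e + 1, e + 2, ...

start-suc : ∀ e → start (suc e) ≡ start e + suc e + suc e
start-suc = solve 1 (λ e → (con 1 :+ e) :* (con 1 :+ (con 1 :+ e)) :=
                          e :* (con 1 :+ e) :+ (con 1 :+ e) :+ (con 1 :+ e)) refl

start-mono : ∀ {e e′} → e ≤ e′ → start e ≤ start e′
start-mono e≤e′ = *-mono-≤ e≤e′ (s≤s e≤e′)

I-below : ∀ {e e′} → e < e′ → start e + suc e ≤ start e′
I-below {e} e<e′ = ≤-trans (m≤m+n _ (suc e)) (≤-trans (≤-reflexive (sym (start-suc e))) (start-mono e<e′))

InI : ℕ → ℕ → Set
InI e z = start e ≤ z × z < start e + suc e

InK : ℕ → ℕ → Set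
InK e z = start e + suc e ≤ z × z < start (suc e)

I-unique : ∀ {e e′ z} → InI e z → InI e′ z → e ≡ e′
I-unique {e} {e′} (l , u) (l′ , u′) with <-cmp e e′
... | tri≈ _ e≡e′ _ = e≡e′
... | tri< e<e′ _ _ = ⊥-elim (<-irrefl refl (<-≤-trans u (≤-trans (I-below e<e′) l′)))
... | tri> _ _ e′<e = ⊥-elim (<-irrefl refl (<-≤-trans u′ (≤-trans (I-below e′<e) l)))

K-not-I : ∀ {n e z} → InK n z → ¬ InI e z
K-not-I {n} {e} (l , u) (l′ , u′) with <-cmp e n
... | tri< e<n _ _  = <-irrefl refl (<-≤-trans u′ (≤-trans (I-below e<n) (≤-trans (m≤m+n (start n) (suc n)) l)))
... | tri≈ _ refl _ = <-irrefl refl (<-≤-trans u′ l)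
... | tri> _ _ n<e  = <-irrefl refl (<-≤-trans u (≤-trans (start-mono n<e) l′))

Found : ℕ → Set
Found z = Σ ℕ λ e → Σ ℕ λ u → First e u z

found-beyond : ∀ {z} (f : Found z) → start (suc (proj₁ f)) ≤ z
found-beyond (e , u , Q≡0 , refl , _) = m∸n≡0⇒m≤n (m+n≡0⇒n≡0 (T e (fst u) (snd u)) Q≡0)

found-index : ∀ {z b} (f : Found z) → z < start (suc b) → proj₁ f < b
found-index {z} {b} f z<start with proj₁ f <? b
... | yes e<b = e<b
... | no  e≮b = ⊥-elim (<-irrefl refl (<-≤-trans z<start (≤-trans (start-mono (s≤s (≮⇒≥ e≮b))) (found-beyond f))))

-- Each index contributes at most one element: the least zero of Q e is unique.
found-unique : ∀ {z z′} (f : Found z) (f′ : Found z′) → proj₁ f ≡ proj₁ f′ → z ≡ z′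
found-unique (e , u , Q≡0 , refl , least) (.e , u′ , Q′≡0 , refl , least′) refl with <-cmp u u′
... | tri≈ _ u≡u′ _ = cong fst u≡u′
... | tri< u<u′ _ _ with () ← trans (sym Q≡0) (proj₂ (least′ u u<u′))
... | tri> _ _ u′<u with () ← trans (sym Q′≡0) (proj₂ (least u′ u′<u))

-- Hence b + 1 distinct numbers below start (b + 1) cannot all be found: pigeonhole.
not-all-found : ∀ b (g : Fin (suc b) → ℕ) → Injective _≡_ _≡_ g → (∀ i → g i < start (suc b)) → ¬ (∀ i → Found (g i))
not-all-found b g g-inj g< found
  with i , j , i<j , same ← pigeonhole (n<1+n b) (λ i → fromℕ< (found-index (found i) (g< i))) =
  Fin-<-irrefl (g-inj (found-unique (found i) (found j) index-eq)) i<j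
  where
  index-eq : proj₁ (found i) ≡ proj₁ (found j)
  index-eq = trans (sym (toℕ-fromℕ< (found-index (found i) (g< i))))
                   (trans (cong toℕ same) (toℕ-fromℕ< (found-index (found j) (g< j))))

some-not-found : ExcludedMiddle 0ℓ → ∀ b (g : Fin (suc b) → ℕ) → Injective _≡_ _≡_ g → (∀ i → g i < start (suc b)) →
                 Σ (Fin (suc b)) λ i → ¬ Found (g i)
some-not-found em b g g-inj g< with em {Σ (Fin (suc b)) λ i → ¬ Found (g i)}
... | yes some = some
... | no  none = ⊥-elim (not-all-found b g g-inj g< λ i → decidable-stable em (λ ¬found → none (i , ¬found)))

not-in-A : ∀ {z} → ¬ Found z → (∀ e u → ¬ Zeroed e u z) → ¬ A z
not-in-A {z} ¬found ¬zeroed a = excluded (Equivalence.to (A⇔ z) a)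
  where
  excluded : InA z → ⊥
  excluded (e , u , inj₁ first)  = ¬found (e , u , first)
  excluded (e , u , inj₂ zeroed) = ¬zeroed e u zeroed

K-point : ∀ n → Fin (suc n) → ℕ
K-point n i = start n + suc n + toℕ i

K-point-inj : ∀ n → Injective _≡_ _≡_ (K-point n)
K-point-inj n eq = toℕ-injective (+-cancelˡ-≡ (start n + suc n) _ _ eq)

K-point< : ∀ n i → K-point n i < start (suc n)
K-point< n i = ≤-trans (+-monoʳ-< (start n + suc n) (toℕ<n i)) (≤-reflexive (sym (start-suc n)))

co-infinite : ExcludedMiddle 0ℓ → Infinite (λ z → ¬ A z)
co-infinite em n with i , ¬found ← some-not-found em n (K-point n) (K-point-inj n) (K-point< n) =
  K-point n i , ≤-trans (n≤1+n n) (≤-trans (m≤n+m (suc n) (start n)) (m≤m+n _ (toℕ i))) ,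
  not-in-A ¬found (λ e u (l , u< , _) → K-not-I (m≤m+n _ (toℕ i) , K-point< n i) (l , u<))

Q-pair : ∀ e z L → Q e (pair z L) ≡ T e z L + (start (suc e) ∸ z)
Q-pair e z L = cong₂ (λ z L → T e z L + (start (suc e) ∸ z)) (fst-pair z L) (snd-pair z L)

-- A meets every infinite r.e. set B = W_c: B has an element beyond the blocks of c,
-- so the first such element found in W_c lies in A.
meets-infinite : ∀ (B : Pred) → IsRE B → (∀ z → B z → ¬ A z) → ¬ Infinite B
meets-infinite B (c , B⇔W) disjoint infinite = disjoint (fst u) u∈B u∈A
  where
  far : Σ ℕ λ m → start (suc c) ≤ m × B m
  far = infinite (start (suc c))
  m : ℕ
  m = proj₁ far
  halts : Halts c m
  halts = proj₁ (B⇔W m) (proj₂ (proj₂ far))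
  trace : Σ ℕ λ L → T c m L ≡ 0 × out (hd L) ≡ proj₁ halts
  trace = T-complete c m (proj₁ halts) (proj₂ halts)
  least : Σ ℕ λ u → Q c u ≡ 0 × (∀ k → k < u → Positive (Q c k))
  least = least-zero (Q c) (pair m (proj₁ trace))
    (trans (Q-pair c m (proj₁ trace)) (cong₂ _+_ (proj₁ (proj₂ trace)) (m≤n⇒m∸n≡0 (proj₁ (proj₂ far)))))
  u : ℕ
  u = proj₁ least
  u∈A : A (fst u)
  u∈A = Equivalence.from (A⇔ (fst u)) (c , u , inj₁ (proj₁ (proj₂ least) , refl , proj₂ (proj₂ least)))
  u∈B : B (fst u)
  u∈B = proj₂ (B⇔W (fst u)) (_ , T-sound c (fst u) (snd u) (m+n≡0⇒m≡0 _ (proj₁ (proj₂ least))))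

∈D-shift : ∀ k m z → k ≤ z → (z ∸ k) ∈D m → z ∈D (2 ^ k * m)
∈D-shift zero    m z       _         z∈m = subst (z ∈D_) (sym (+-identityʳ m)) z∈m
∈D-shift (suc k) m (suc z) (s≤s k≤z) z∈m = subst (z ∈D_) (sym halve) (∈D-shift k m z k≤z z∈m)
  where
  halve : 2 * 2 ^ k * m / 2 ≡ 2 ^ k * m
  halve = trans (cong (_/ 2) (trans (*-assoc 2 (2 ^ k) m) (*-comm 2 (2 ^ k * m)))) (m*n/n≡m (2 ^ k * m) 2)

odd-% : ∀ n → suc (n * 2) % 2 ≡ 1
odd-% n = [m+kn]%n≡m%n 1 n 2

odd-/ : ∀ n → suc (n * 2) / 2 ≡ n
odd-/ n = trans (+-distrib-/ 1 (n * 2) (subst (λ r → 1 + r < 2) (sym (m*n%n≡0 n 2)) ≤-refl)) (m*n/n≡m n 2)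

ones-suc : ∀ j → 2 ^ suc j ∸ 1 ≡ suc ((2 ^ j ∸ 1) * 2)
ones-suc j = double-pred (2 ^ j) {{m^n≢0 2 j}}
  where
  double-pred : ∀ p .{{_ : NonZero p}} → 2 * p ∸ 1 ≡ suc ((p ∸ 1) * 2)
  double-pred (suc q) = trans (+-suc q (q + 0)) (cong suc (*-comm 2 q))

∈D-ones : ∀ j z → z < j → z ∈D (2 ^ j ∸ 1)
∈D-ones (suc j) zero    _         = subst (λ n → n % 2 ≡ 1) (sym (ones-suc j)) (odd-% (2 ^ j ∸ 1))
∈D-ones (suc j) (suc z) (s≤s z<j) =
  subst (λ n → z ∈D (n / 2)) (sym (ones-suc j)) (subst (z ∈D_) (sym (odd-/ (2 ^ j ∸ 1))) (∈D-ones j z z<j))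

I-code : ℕ → ℕ
I-code e = 2 ^ start e * (2 ^ suc e ∸ 1)

I∈D : ∀ {e z} → InI e z → z ∈D I-code e
I∈D {e} {z} (l , u) = ∈D-shift (start e) _ z l (∈D-ones (suc e) (z ∸ start e)
  (subst (z ∸ start e <_) (m+n∸m≡n (start e) (suc e)) (∸-monoˡ-< u l)))

opaque
  I-code′ : Prog I-code
  I-code′ = (2^′ ∘′ start′ I′) *′ (2^′ ∘′ S′ ∸′ K′ 1)

  I-code-index : Σ ℕ λ n → decode n ≡ code I-code′
  I-code-index = encode (code I-code′) , decode-encode (code I-code′)

I-code-computable : IsComputable I-code
I-code-computable =
  proj₁ I-code-index , λ n → subst (λ c → c ⟦ n ⟧⇓ I-code n) (sym (proj₂ I-code-index)) (runs I-code′ n)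

I-point : ∀ e → Fin (suc e) → ℕ
I-point e i = start e + toℕ i

I-point-inj : ∀ e → Injective _≡_ _≡_ (I-point e)
I-point-inj e eq = toℕ-injective (+-cancelˡ-≡ (start e) _ _ eq)

I-point-in : ∀ e i → InI e (I-point e i)
I-point-in e i = m≤m+n (start e) (toℕ i) , +-monoʳ-< (start e) (toℕ<n i)

I-point< : ∀ e i → I-point e i < start (suc e)
I-point< e i = ≤-trans (proj₂ (I-point-in e i)) (≤-trans (m≤m+n _ (suc e)) (≤-reflexive (sym (start-suc e))))

ZeroOnI : ℕ → Set
ZeroOnI e = Σ ℕ λ z → InI e z × e ⟦ z ⟧φ⇓ 0

Disagrees : ℕ → Set
Disagrees e = Σ ℕ λ z → z ∈D I-code e × Σ ℕ λ v → e ⟦ z ⟧φ⇓ v × ¬ IsIndicator A z v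

-- If φ_e(z) = 0 for some z ∈ I_e, then z was put into A.
zero-disagrees : ∀ e → ZeroOnI e → Disagrees e
zero-disagrees e (z , inI , φz≡0) = z , I∈D inI , 0 , φz≡0 , not-indicator
  where
  trace : Σ ℕ λ L → T e z L ≡ 0 × out (hd L) ≡ 0
  trace = T-complete e z 0 φz≡0
  z∈A : A z
  z∈A = Equivalence.from (A⇔ z) (e , proj₁ trace , inj₂ (proj₁ inI , proj₂ inI , proj₂ trace))
  not-indicator : ¬ IsIndicator A z 0
  not-indicator (inj₁ (_ , ()))
  not-indicator (inj₂ (z∉A , _)) = z∉A z∈A

-- Otherwise some z ∈ I_e is not found, hence not in A, while φ_e(z) is positive.
positive-disagrees : ExcludedMiddle 0ℓ → ∀ e → ¬ ZeroOnI e → (∀ z → z ∈D I-code e → Halts e z) → Disagrees e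
positive-disagrees em e ¬zero halts = z , I∈D inI , proj₁ run , proj₂ run , not-indicator
  where
  picked : Σ (Fin (suc e)) λ i → ¬ Found (I-point e i)
  picked = some-not-found em e (I-point e) (I-point-inj e) (I-point< e)
  z : ℕ
  z = I-point e (proj₁ picked)
  inI : InI e z
  inI = I-point-in e (proj₁ picked)
  run : Halts e z
  run = halts z (I∈D inI)
  z∉A : ¬ A z
  z∉A = not-in-A (proj₂ picked) λ where
    e′ u (l , u< , T≡0 , out≡0) → ¬zero (z , inI ,
      subst₂ (λ e″ v → e″ ⟦ z ⟧φ⇓ v) (I-unique (l , u<) inI) out≡0 (T-sound e′ z u T≡0))
  not-indicator : ¬ IsIndicator A z (proj₁ run)
  not-indicator (inj₁ (z∈A , _))    = z∉A z∈A
  not-indicator (inj₂ (_ , v≡0)) = ¬zero (z , inI , subst (e ⟦ z ⟧φ⇓_) v≡0 (proj₂ run))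

A-DWEU : ExcludedMiddle 0ℓ → IsDWEU A
A-DWEU em = I-code , I-code-computable , λ e halts → decide e halts (em {ZeroOnI e})
  where
  decide : ∀ e → (∀ z → z ∈D I-code e → Halts e z) → Dec (ZeroOnI e) → Disagrees e
  decide e halts (yes vanishes) = zero-disagrees e vanishes
  decide e halts (no ¬zero) = positive-disagrees em e ¬zero halts

mainTheorem11 : ExcludedMiddle 0ℓ → Σ Pred λ A → IsRE A × IsSimple A × IsDWEU A
mainTheorem11 em = A , (proj₁ A-index , λ z → (λ a → a) , (λ h → h)) , (co-infinite em , meets-infinite) , A-DWEU em
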